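{- Let $\mathcal{L}$ be the language of expertise with the semantics described in the context. For any formulas $\phi, \psi \in \mathcal{L}$ and any expertise model $M$: 1. $\mathsf{E}\phi \equiv \mathsf{E}\neg\phi \equiv \mathsf{A}\mathsf{E}\phi$; 2. either $M \vDash \mathsf{E}\phi$ or $M \vDash \neg\mathsf{E}\phi$; 3. $\vDash \mathsf{E}\top \wedge \mathsf{E}\bot \wedge \mathsf{E}\mathsf{E}\phi$; 4. $\vDash (\mathsf{E}\phi \wedge \mathsf{E}\psi) \rightarrow \mathsf{E}(\phi \wedge \psi)$; 5. the distribution axiom $\mathsf{E}(\phi \rightarrow \psi) \rightarrow (\mathsf{E}\phi \rightarrow \mathsf{E}\psi)$ is not in general valid (i.e. there exist formulas $\phi,\psi$ for which it is not valid); 6. $\vDash \phi \rightarrow \mathsf{S}\phi$; 7. if $\vDash \phi \rightarrow \psi$ then $\vDash (\mathsf{S}\phi \wedge \mathsf{E}\psi) \rightarrow \psi$.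
   Context: Let $\mathsf{Prop}$ be a countable set of propositional variables. The language $\mathcal{L}$ is given by $\phi ::= p \mid \neg\phi \mid \phi\wedge\phi \mid \mathsf{E}\phi \mid \mathsf{S}\phi \mid \mathsf{A}\phi$ for $p \in \mathsf{Prop}$; other Boolean connectives and $\top,\bot$ are abbreviations. An expertise frame is a pair $(X,P)$ with $X$ a set and $P \subseteq 2^X$ such that (P1) $X \in P$; (P2) if $A \in P$ then $X\setminus A \in P$; (P3) $P$ is closed under arbitrary intersections: if $\{A_i\}_{i\in I}\subseteq P$ then $\bigcap_{i\in I}A_i \in P$. An expertise model is $M=(X,P,v)$ with $(X,P)$ an expertise frame and $v:\mathsf{Prop}\to 2^X$. Satisfaction: $M,x\vDash p$ iff $x\in v(p)$; Boolean clauses standard; $M,x\vDash \mathsf{E}\phi$ iff $\|\phi\|_M \in P$; $M,x\vDash\mathsf{S}\phi$ iff for all $A\in P$, $\|\phi\|_M\subseteq A$ implies $x\in A$; $M,x\vDash\mathsf{A}\phi$ iff $M,y\vDash\phi$ for all $y\in X$; where $\|\phi\|_M=\{x\in X\mid M,x\vDash\phi\}$. $M\vDash\phi$ means $M,x\vDash\phi$ for all $x\in X$; $\vDash\phi$ ($\phi$ valid) means $M\vDash\phi$ for all expertise models $M$; $\phi\equiv\psi$ means $\vDash\phi\leftrightarrow\psi$. -}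

module Defs where

open import Data.Nat using (ℕ)
open import Data.Bool using (Bool; true; false; not)
open import Data.Product using (Σ; _×_; _,_)
open import Data.Empty using (⊥)
open import Relation.Nullary using (¬_)
open import Relation.Binary.PropositionalEquality using (_≡_)

PropVar : Set
PropVar = ℕ

infixr 6 _∧_
infix 7 ~_
data Form : Set where
  var : PropVar → Form
  ~_  : Form → Form
  _∧_ : Form → Form → Form
  E   : Form → Form
  S   : Form → Form
  𝐀   : Form → Form

infixr 4 _⇒_
infixr 5 _∨_
infix 3 _⇔_
_∨_ : Form → Form → Form
φ ∨ ψ = ~ (~ φ ∧ ~ ψ)

_⇒_ : Form → Form → Form
φ ⇒ ψ = ~ (φ ∧ ~ ψ)

_⇔_ : Form → Form → Form
φ ⇔ ψ = (φ ⇒ ψ) ∧ (ψ ⇒ φ)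

⊤f : Form
⊤f = ~ (var 0 ∧ ~ var 0)

⊥f : Form
⊥f = ~ ⊤f

Subset : Set → Set
Subset X = X → Bool

_∈_ : {X : Set} → X → Subset X → Set
x ∈ A = A x ≡ true

-- Extensional equality of subsets (no function extensionality available).
_≐_ : {X : Set} → Subset X → Subset X → Set
A ≐ B = ∀ x → A x ≡ B x

record Frame : Set₁ where
  field
    X : Set
    P : Subset X → Set
    -- P is a set of subsets, so membership respects equality of subsets
    P-ext : ∀ {A B} → A ≐ B → P A → P B
    P1 : P (λ _ → true)
    P2 : ∀ {A} → P A → P (λ x → not (A x))
    -- (P3) closure under arbitrary intersections: any B equal to the
    -- intersection of a family of members of P is in P
    P3 : (I : Set) (A : I → Subset X) (B : Subset X) →
         (∀ i → P (A i)) →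
         (∀ x → (x ∈ B → ∀ i → x ∈ A i) × ((∀ i → x ∈ A i) → x ∈ B)) →
         P B

record Model : Set₁ where
  field
    frame : Frame
  open Frame frame public
  field
    v : PropVar → Subset X

open Model public

_,_⊨_ : (M : Model) → X M → Form → Set
M , x ⊨ var p = x ∈ v M p
M , x ⊨ (~ φ) = ¬ (M , x ⊨ φ)
M , x ⊨ (φ ∧ ψ) = (M , x ⊨ φ) × (M , x ⊨ ψ)
M , x ⊨ E φ = Σ (Subset (X M)) λ A → P M A ×
                 (∀ y → (y ∈ A → M , y ⊨ φ) × (M , y ⊨ φ → y ∈ A))
M , x ⊨ S φ = (A : Subset (X M)) → P M A →
                 (∀ y → M , y ⊨ φ → y ∈ A) → x ∈ A
M , x ⊨ 𝐀 φ = ∀ y → M , y ⊨ φ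

_⊨M_ : Model → Form → Set
M ⊨M φ = ∀ x → M , x ⊨ φ

Valid : Form → Set₁
Valid φ = ∀ M → M ⊨M φ

_≡s_ : Form → Form → Set₁
φ ≡s ψ = Valid (φ ⇔ ψ)

-- The truth set of E φ does not depend on the point, so (classically) it is X or ∅, and
-- X and ∅ belong to P by P1 and P2; P2 and P3 make P closed under complements and binary
-- intersections. Distribution fails in the two-point frame with P = {∅, X}: there ⊥ ⇒ p
-- and ⊥ have truth sets X and ∅, while the truth set of p is a single point.
module Submission where

open import Defs
open import Level using (0ℓ)
open import Axiom.ExcludedMiddle using (ExcludedMiddle)
open import Axiom.DoubleNegationElimination using (em⇒dne)
open import Data.Bool using (Bool; true; false; not) renaming (_∧_ to _&&_)
open import Data.Bool.Properties using (∧-conicalˡ; ∧-conicalʳ)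
open import Data.Empty using (⊥-elim)
open import Data.Product using (Σ; _×_; _,_; proj₁; proj₂)
open import Data.Sum as Sum using (_⊎_; inj₁; inj₂)
open import Function using (id)
open import Relation.Nullary using (¬_; yes; no)
open import Relation.Binary.PropositionalEquality
  using (_≡_; _≢_; refl; sym; trans; cong; cong₂)

not≡true⇒≢true : ∀ {b} → not b ≡ true → b ≢ true
not≡true⇒≢true {false} _ ()

≢true⇒not≡true : ∀ {b} → b ≢ true → not b ≡ true
≢true⇒not≡true {false} _ = refl
≢true⇒not≡true {true}  b≢true = ⊥-elim (b≢true refl)

≡true⇔⇒≡ : ∀ {a b} → (a ≡ true → b ≡ true) → (b ≡ true → a ≡ true) → a ≡ b
≡true⇔⇒≡ {true}          a⇒b _ = sym (a⇒b refl)
≡true⇔⇒≡ {false} {true}  _ b⇒a = b⇒a refl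
≡true⇔⇒≡ {false} {false} _ _   = refl

-- Formulas are passed explicitly: M , x ⊨ φ computes on φ, so φ is never inferable from it.
module _ (M : Model) where

  Represents : Subset (X M) → Form → Set
  Represents A φ = ∀ y → (y ∈ A → M , y ⊨ φ) × (M , y ⊨ φ → y ∈ A)

  -- M , x ⊨ E φ unfolds to Expert φ, whatever x is.
  Expert : Form → Set
  Expert φ = Σ (Subset (X M)) λ A → P M A × Represents A φ

  ⊨⊤f : ∀ x → M , x ⊨ ⊤f
  ⊨⊤f x (p , ¬p) = ¬p p

  ⊭⊥f : ∀ x → ¬ (M , x ⊨ ⊥f)
  ⊭⊥f x ⊥ = ⊥ (⊨⊤f x)

  ⊨⇒-intro : ∀ {x} φ ψ → (M , x ⊨ φ → M , x ⊨ ψ) → M , x ⊨ (φ ⇒ ψ)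
  ⊨⇒-intro φ ψ φ⇒ψ (p , ¬q) = ¬q (φ⇒ψ p)

  ⊨⇔-intro : ∀ {x} φ ψ → (M , x ⊨ φ → M , x ⊨ ψ) → (M , x ⊨ ψ → M , x ⊨ φ) →
             M , x ⊨ (φ ⇔ ψ)
  ⊨⇔-intro φ ψ φ⇒ψ ψ⇒φ = ⊨⇒-intro φ ψ φ⇒ψ , ⊨⇒-intro ψ φ ψ⇒φ

  ⊭⇒ : ∀ {x} φ ψ → M , x ⊨ φ → ¬ (M , x ⊨ ψ) → ¬ (M , x ⊨ (φ ⇒ ψ))
  ⊭⇒ φ ψ p ¬q φ⇒ψ = φ⇒ψ (p , ¬q)

  expert-cong : ∀ φ ψ → (∀ y → M , y ⊨ φ → M , y ⊨ ψ) → (∀ y → M , y ⊨ ψ → M , y ⊨ φ) →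
                Expert φ → Expert ψ
  expert-cong φ ψ φ⇒ψ ψ⇒φ (A , A∈P , A≈φ) =
    A , A∈P , λ y → (λ y∈A → φ⇒ψ y (proj₁ (A≈φ y) y∈A)) , (λ q → proj₂ (A≈φ y) (ψ⇒φ y q))

  expert-everywhere : ∀ φ → M ⊨M φ → Expert φ
  expert-everywhere φ everywhere = (λ _ → true) , P1 M , λ y → (λ _ → everywhere y) , (λ _ → refl)

  expert-nowhere : ∀ φ → M ⊨M (~ φ) → Expert φ
  expert-nowhere φ nowhere =
    (λ _ → false) , P2 M (P1 M) , λ y → (λ ()) , (λ p → ⊥-elim (nowhere y p))

  expert-⊤f : Expert ⊤f
  expert-⊤f = expert-everywhere ⊤f ⊨⊤f

  expert-⊥f : Expert ⊥f
  expert-⊥f = expert-nowhere ⊥f ⊭⊥f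

  expert-~ : ∀ φ → Expert φ → Expert (~ φ)
  expert-~ φ (A , A∈P , A≈φ) =
    (λ y → not (A y)) , P2 M A∈P , λ y →
      (λ y∉A p → not≡true⇒≢true y∉A (proj₂ (A≈φ y) p))
    , (λ ¬p → ≢true⇒not≡true (λ y∈A → ¬p (proj₁ (A≈φ y) y∈A)))

  expert-∧ : ∀ φ ψ → Expert φ → Expert ψ → Expert (φ ∧ ψ)
  expert-∧ φ ψ (A , A∈P , A≈φ) (B , B∈P , B≈ψ) =
    A∩B , P3 M Bool family A∩B family∈P A∩B≈⋂ , λ y →
      (λ y∈A∩B → proj₁ (A≈φ y) (∧-conicalˡ _ _ y∈A∩B) , proj₁ (B≈ψ y) (∧-conicalʳ _ _ y∈A∩B))
    , (λ { (p , q) → cong₂ _&&_ (proj₂ (A≈φ y) p) (proj₂ (B≈ψ y) q) })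
    where
    A∩B : Subset (X M)
    A∩B y = A y && B y
    family : Bool → Subset (X M)
    family true  = A
    family false = B
    family∈P : ∀ i → P M (family i)
    family∈P true  = A∈P
    family∈P false = B∈P
    A∩B≈⋂ : ∀ y → (y ∈ A∩B → ∀ i → y ∈ family i) × ((∀ i → y ∈ family i) → y ∈ A∩B)
    A∩B≈⋂ y = (λ { y∈A∩B true → ∧-conicalˡ _ _ y∈A∩B ; y∈A∩B false → ∧-conicalʳ _ _ y∈A∩B })
             , (λ y∈⋂ → cong₂ _&&_ (y∈⋂ true) (y∈⋂ false))

  S-reflexive : ∀ {x} φ → M , x ⊨ φ → M , x ⊨ S φ
  S-reflexive {x} φ p A _ ‖φ‖⊆A = ‖φ‖⊆A x p

  S-expert-consequence : ∀ {x} φ ψ → (∀ y → M , y ⊨ φ → M , y ⊨ ψ) →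
                         Expert ψ → M , x ⊨ S φ → M , x ⊨ ψ
  S-expert-consequence {x} φ ψ φ⇒ψ (A , A∈P , A≈ψ) s =
    proj₁ (A≈ψ x) (s A A∈P λ y p → proj₂ (A≈ψ y) (φ⇒ψ y p))

-- P = {∅, X}; it is closed under intersections because an intersection of constant sets is constant.
constantFrame : Set → Frame
constantFrame X = record
  { X     = X
  ; P     = IsConstant
  ; P-ext = λ A≐B A-const x y → trans (sym (A≐B x)) (trans (A-const x y) (A≐B y))
  ; P1    = λ _ _ → refl
  ; P2    = λ A-const x y → cong not (A-const x y)
  ; P3    = λ I A B A-const B≈⋂ x y →
              ≡true⇔⇒≡ (transfer I A B A-const B≈⋂ x y) (transfer I A B A-const B≈⋂ y x)
  }
  where
  IsConstant : Subset X → Set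
  IsConstant A = ∀ x y → A x ≡ A y
  transfer : (I : Set) (A : I → Subset X) (B : Subset X) → (∀ i → IsConstant (A i)) →
             (∀ x → (x ∈ B → ∀ i → x ∈ A i) × ((∀ i → x ∈ A i) → x ∈ B)) →
             ∀ x y → x ∈ B → y ∈ B
  transfer I A B A-const B≈⋂ x y x∈B =
    proj₂ (B≈⋂ y) λ i → trans (sym (A-const i x y)) (proj₁ (B≈⋂ x) x∈B i)

boolModel : Model
boolModel = record { frame = constantFrame Bool ; v = λ _ → id }

¬expert-var : ∀ p → ¬ Expert boolModel (var p)
¬expert-var p (A , A-const , A≈p) =
  false≢true (proj₁ (A≈p false) (trans (A-const false true) (proj₂ (A≈p true) refl)))
  where
  false≢true : false ≢ true
  false≢true ()

distribution-invalid : ∀ p → ¬ Valid (E (⊥f ⇒ var p) ⇒ (E ⊥f ⇒ E (var p)))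
distribution-invalid p valid =
  ⊭⇒ boolModel {true} (E (⊥f ⇒ var p)) (E ⊥f ⇒ E (var p)) expert-⊥f⇒p
     (⊭⇒ boolModel {true} (E ⊥f) (E (var p)) (expert-⊥f boolModel) (¬expert-var p))
     (valid boolModel true)
  where
  expert-⊥f⇒p : Expert boolModel (⊥f ⇒ var p)
  expert-⊥f⇒p = expert-everywhere boolModel (⊥f ⇒ var p) λ y →
    ⊨⇒-intro boolModel ⊥f (var p) λ ⊥ → ⊥-elim (⊭⊥f boolModel y ⊥)

module Classical (lem : ExcludedMiddle 0ℓ) where

  ⊨⇒-elim : ∀ M {x} φ ψ → M , x ⊨ (φ ⇒ ψ) → M , x ⊨ φ → M , x ⊨ ψ
  ⊨⇒-elim M φ ψ φ⇒ψ p = em⇒dne lem λ ¬q → φ⇒ψ (p , ¬q)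

  expert-~⁻¹ : ∀ M φ → Expert M (~ φ) → Expert M φ
  expert-~⁻¹ M φ e =
    expert-cong M (~ ~ φ) φ (λ _ → em⇒dne lem) (λ _ p ¬p → ¬p p) (expert-~ M (~ φ) e)

  expert-or-not : ∀ M φ → Expert M φ ⊎ ¬ Expert M φ
  expert-or-not M φ with lem {Expert M φ}
  ... | yes e  = inj₁ e
  ... | no ¬e = inj₂ ¬e

  expert-E : ∀ M φ → Expert M (E φ)
  expert-E M φ with expert-or-not M φ
  ... | inj₁ e  = expert-everywhere M (E φ) λ _ → e
  ... | inj₂ ¬e = expert-nowhere M (E φ) λ _ → ¬e

  E≡E~ : ∀ φ → E φ ≡s E (~ φ)
  E≡E~ φ M x = ⊨⇔-intro M {x} (E φ) (E (~ φ)) (expert-~ M φ) (expert-~⁻¹ M φ)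

  E~≡𝐀E : ∀ φ → E (~ φ) ≡s 𝐀 (E φ)
  E~≡𝐀E φ M x = ⊨⇔-intro M {x} (E (~ φ)) (𝐀 (E φ))
    (λ e _ → expert-~⁻¹ M φ e) (λ everywhere → expert-~ M φ (everywhere x))

  E-uniform : ∀ M φ → (M ⊨M E φ) ⊎ (M ⊨M (~ E φ))
  E-uniform M φ = Sum.map (λ e _ → e) (λ ¬e _ → ¬e) (expert-or-not M φ)

  ⊨S∧E⇒ : ∀ φ ψ → Valid (φ ⇒ ψ) → Valid ((S φ ∧ E ψ) ⇒ ψ)
  ⊨S∧E⇒ φ ψ valid M x = ⊨⇒-intro M (S φ ∧ E ψ) ψ λ { (s , eψ) →
    S-expert-consequence M φ ψ (λ y → ⊨⇒-elim M φ ψ (valid M y)) eψ s }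

proposition1 : ExcludedMiddle 0ℓ →
    (∀ φ → (E φ ≡s E (~ φ)) × (E (~ φ) ≡s 𝐀 (E φ)))
    × (∀ (M : Model) φ → (M ⊨M E φ) ⊎ (M ⊨M (~ E φ)))
    × (∀ φ → Valid (E ⊤f ∧ E ⊥f ∧ E (E φ)))
    × (∀ φ ψ → Valid ((E φ ∧ E ψ) ⇒ E (φ ∧ ψ)))
    × (Σ Form λ φ → Σ Form λ ψ → ¬ Valid (E (φ ⇒ ψ) ⇒ (E φ ⇒ E ψ)))
    × (∀ φ → Valid (φ ⇒ S φ))
    × (∀ φ ψ → Valid (φ ⇒ ψ) → Valid ((S φ ∧ E ψ) ⇒ ψ))
proposition1 lem =
    (λ φ → E≡E~ φ , E~≡𝐀E φ)
  , E-uniform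
  , (λ φ M x → expert-⊤f M , expert-⊥f M , expert-E M φ)
  , (λ φ ψ M x → ⊨⇒-intro M {x} (E φ ∧ E ψ) (E (φ ∧ ψ)) λ { (eφ , eψ) → expert-∧ M φ ψ eφ eψ })
  , (⊥f , var 0 , distribution-invalid 0)
  , (λ φ M x → ⊨⇒-intro M {x} φ (S φ) (S-reflexive M φ))
  , ⊨S∧E⇒
  where open Classical lem
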